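{- For every even $r\ge 4$, $2^r\le \zeta_e(BF(r))\le \left(\frac{r}{2}+2\right)2^{r-1}$.
   Context: The $r$-dimensional butterfly network $BF(r)$ has vertex set $\{[w;i] : w\in\{0,1\}^r,\ 0\le i\le r\}$, and $[w;i]$ is adjacent to $[w';j]$ iff $j=i+1$ and either $w=w'$ or $w$ and $w'$ differ precisely in the $j$-th bit. Forcing (closure) rule: for a graph $G=(V,E)$ and $T\subseteq V$, the closure $C_G(T)$ starts as $T$ and, as long as some vertex of $C_G(T)$ has exactly one neighbor not in $C_G(T)$, that neighbor is added. Edge-forcing set: a set $K$ of pairwise independent edges of $G$ such that, with $T$ the set of endpoints of edges of $K$, $C_G(T)=V$. $\zeta_e(G)$ is the minimum cardinality of an edge-forcing set of $G$. -}

module Defs where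

open import Data.Nat using (ℕ; suc)
open import Data.Bool using (Bool; not)
open import Data.Fin using (Fin; toℕ)
open import Data.Vec using (Vec; _[_]%=_)
open import Data.Product using (_×_; _,_; Σ; proj₁; proj₂)
open import Data.Sum using (_⊎_)
open import Data.List using (List)
open import Data.List.Relation.Unary.All using (All)
open import Data.List.Relation.Unary.Any using (Any)
open import Data.List.Relation.Unary.AllPairs using (AllPairs)
open import Relation.Binary.PropositionalEquality using (_≡_; _≢_)

BFVertex : ℕ → Set
BFVertex r = Vec Bool r × Fin (suc r)

-- Directed form of the definition: [w;i] → [w';j] with j = i+1 and either
-- w = w', or w, w' differ precisely in the j-th bit (bits numbered 1..r,
-- so bit j is the vector position k : Fin r with toℕ k + 1 = j).
BFAdj : (r : ℕ) → BFVertex r → BFVertex r → Set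
BFAdj r (w , i) (w' , j) =
  (toℕ j ≡ suc (toℕ i)) ×
  ((w ≡ w') ⊎ Σ (Fin r) (λ k → (suc (toℕ k) ≡ toℕ j) × (w' ≡ w [ k ]%= not)))

BFEdge : (r : ℕ) → BFVertex r → BFVertex r → Set
BFEdge r u v = BFAdj r u v ⊎ BFAdj r v u

data Closure {V : Set} (E : V → V → Set) (T : V → Set) : V → Set where
  base  : ∀ {v} → T v → Closure E T v
  force : ∀ {u v} → Closure E T u → E u v →
          (∀ x → E u x → x ≢ v → Closure E T x) → Closure E T v

Independent : {V : Set} → V × V → V × V → Set
Independent (a , b) (c , d) = (a ≢ c) × (a ≢ d) × (b ≢ c) × (b ≢ d)

Endpoints : {V : Set} → List (V × V) → V → Set
Endpoints K v = Any (λ e → (v ≡ proj₁ e) ⊎ (v ≡ proj₂ e)) K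

-- K is an edge-forcing set: a set of pairwise independent edges whose
-- endpoint set has closure equal to all of V.  (Pairwise independence of
-- the list entries forces them to be distinct, so length K = |K|.)
IsEdgeForcingSet : {V : Set} → (V → V → Set) → List (V × V) → Set
IsEdgeForcingSet E K =
  All (λ e → E (proj₁ e) (proj₂ e)) K ×
  AllPairs Independent K ×
  (∀ v → Closure E (Endpoints K) v)

{-# OPTIONS --safe #-}
-- For x ∈ {0,1}^r the vertices [x;0] and [x+e₁;0] have the same neighbourhood,
-- and so do [x;r] and [x+e_r;r].  Neither vertex of such a twin pair can be the one forced by
-- the closure rule, because the other twin is a second neighbour outside the closure; so each
-- of these 2^r pairs contains an endpoint of K.  No edge joins two vertices of level 0 or r
-- (as r ≥ 2), hence different pairs use different edges of K.
--
-- Upper bound, r = 2q.  K consists of the straight edges [w;0][w;1] for all w, the straight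
-- edges [w;2t][w;2t+1] with w_{2t} + … + w_r even for 1 ≤ t ≤ q-1, and the straight edges
-- [w;r-1][w;r] with w_{r-2} + … + w_r odd.  Levels 0 and 1 are covered by K.  Each selecting
-- parity changes when one of its bits is flipped, so for every level ℓ ≥ 2 and every w one of
-- [w;ℓ], [w+e_ℓ;ℓ] is an endpoint, and in the second case [w;ℓ-1] forces [w;ℓ].  Layers at
-- levels 2t are two apart and the two layers meeting at level r-1 select complementary w, so
-- the edges are independent; there are 2^r + (q-1)·2^(r-1) + 2^(r-1) = (q+2)·2^(r-1) of them.

module Submission where

open import Defs
open import Data.Nat using (ℕ; zero; suc; _≤_; _<_; _^_; _*_; _+_; _∸_; _/_; z≤n; s≤s)
open import Data.Nat.Properties
  using (≤-refl; ≤-reflexive; ≤-trans; ≤-<-trans; <-≤-trans; ≤-antisym; ≤-pred; <⇒≢; ≮⇒≥; _<?_;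
         <-cmp; n≤1+n; n<1+n; m≤m+n; m≤n+m; suc-injective; +-identityʳ; +-suc; *-suc; *-comm;
         *-monoʳ-≤; module ≤-Reasoning)
open import Data.Nat.Divisibility using (_∣_; divides)
open import Data.Nat.DivMod using (m*n/n≡m)
open import Data.Nat.Tactic.RingSolver using (solve-∀)
open import Data.Bool using (Bool; true; false; not; _xor_; if_then_else_)
open import Data.Bool.Properties using (not-involutive; not-distribˡ-xor; not-distribʳ-xor)
open import Data.Fin using (Fin; zero; suc; toℕ; fromℕ; inject₁; combine; remQuot)
open import Data.Fin.Properties
  using (toℕ-injective; toℕ-inject₁; toℕ-fromℕ; toℕ-combine; toℕ<n; combine-remQuot; pigeonhole)
open import Data.Fin.Relation.Unary.Top using (view; ‵fromℕ; ‵inject₁)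
open import Data.Vec using (Vec; []; _∷_; _[_]%=_; _∷ʳ_; tail; init)
open import Data.Vec.Properties
  using ([]%=-∘; []%=-id; updateAt-cong; ∷-injectiveʳ; ∷ʳ-injectiveʳ; init-∷ʳ)
open import Data.List using (List; []; _∷_; length; map; _++_; concatMap; lookup; allFin)
open import Data.List.Properties using (length-map; length-++; length-tabulate)
open import Data.List.Membership.Propositional using (_∈_)
open import Data.List.Membership.Propositional.Properties using (∈-map⁺; ∈-allFin; ∈-lookup)
open import Data.List.Relation.Unary.All as All using (All; []; _∷_)
import Data.List.Relation.Unary.All.Properties as All
open import Data.List.Relation.Unary.Any as Any using (Any; here; there)
import Data.List.Relation.Unary.Any.Properties as Any
open import Data.List.Relation.Unary.AllPairs as AllPairs using (AllPairs; []; _∷_)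
import Data.List.Relation.Unary.AllPairs.Properties as AllPairs
open import Data.List.Relation.Unary.Unique.Propositional using (Unique)
import Data.List.Relation.Unary.Unique.Propositional.Properties as Unique
open import Data.Product using (_×_; _,_; Σ; proj₁; proj₂)
open import Data.Sum using (_⊎_; inj₁; inj₂; swap)
open import Data.Empty using (⊥-elim)
open import Function using (_∘_)
open import Relation.Nullary using (¬_; yes; no; contradiction)
open import Relation.Binary.Definitions using (tri<; tri≈; tri>)
open import Relation.Binary.PropositionalEquality
  using (_≡_; _≢_; refl; sym; trans; cong; cong₂; subst; subst₂; ≢-sym; module ≡-Reasoning)

twins-meet : {V : Set} {E : V → V → Set} {T : V → Set} {a b : V} → a ≢ b →
             (∀ {u} → E u a → E u b) → (∀ {u} → E u b → E u a) →
             Closure E T a → T a ⊎ T b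
twins-meet a≢b Na⊆Nb Nb⊆Na (base t) = inj₁ t
twins-meet a≢b Na⊆Nb Nb⊆Na (force _ ua others) =
  swap (twins-meet (≢-sym a≢b) Nb⊆Na Na⊆Nb (others _ (Na⊆Nb ua) (≢-sym a≢b)))

-- Counting Boolean vectors

satisfying : ∀ {n} → (Vec Bool n → Bool) → List (Vec Bool n)
satisfying {zero}  R = if R [] then [] ∷ [] else []
satisfying {suc n} R = map (true ∷_) (satisfying (R ∘ (true ∷_)))
                    ++ map (false ∷_) (satisfying (R ∘ (false ∷_)))

∈-satisfying : ∀ {n} (R : Vec Bool n → Bool) {w} → R w ≡ true → w ∈ satisfying R
∈-satisfying {zero}  R {[]}        Rw rewrite Rw = here refl
∈-satisfying {suc n} R {true ∷ w}  Rw = Any.++⁺ˡ (∈-map⁺ (true ∷_) (∈-satisfying _ Rw))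
∈-satisfying {suc n} R {false ∷ w} Rw = Any.++⁺ʳ _ (∈-map⁺ (false ∷_) (∈-satisfying _ Rw))

satisfying-sound : ∀ {n} (R : Vec Bool n → Bool) → All (λ w → R w ≡ true) (satisfying R)
satisfying-sound {zero} R with R [] in R[]
... | true  = R[] ∷ []
... | false = []
satisfying-sound {suc n} R =
  All.++⁺ (All.map⁺ (satisfying-sound (R ∘ (true ∷_))))
          (All.map⁺ (satisfying-sound (R ∘ (false ∷_))))

satisfying-unique : ∀ {n} (R : Vec Bool n → Bool) → Unique (satisfying R)
satisfying-unique {zero} R with R []
... | true  = [] ∷ []
... | false = []
satisfying-unique {suc n} R =
  AllPairs.++⁺ (Unique.map⁺ ∷-injectiveʳ (satisfying-unique _))
               (Unique.map⁺ ∷-injectiveʳ (satisfying-unique _))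
               (All.map⁺ (All.universal (λ _ → All.map⁺ (All.universal (λ _ ()) _)) _))

count : ∀ {n} → (Vec Bool n → Bool) → ℕ
count R = length (satisfying R)

count-∷ : ∀ {n} (R : Vec Bool (suc n) → Bool) →
          count R ≡ count (R ∘ (true ∷_)) + count (R ∘ (false ∷_))
count-∷ R = trans (length-++ (map (true ∷_) (satisfying (R ∘ (true ∷_)))))
                  (cong₂ _+_ (length-map (true ∷_) (satisfying (R ∘ (true ∷_))))
                              (length-map (false ∷_) (satisfying (R ∘ (false ∷_)))))

count-cong : ∀ {n} {R R′ : Vec Bool n → Bool} → (∀ w → R w ≡ R′ w) → count R ≡ count R′
count-cong {zero}  {R} {R′} R≗R′ rewrite R≗R′ [] = refl
count-cong {suc n} {R} {R′} R≗R′ = begin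
  count R                                           ≡⟨ count-∷ R ⟩
  count (R ∘ (true ∷_)) + count (R ∘ (false ∷_))    ≡⟨ cong₂ _+_ (count-cong (R≗R′ ∘ (true ∷_)))
                                                                  (count-cong (R≗R′ ∘ (false ∷_))) ⟩
  count (R′ ∘ (true ∷_)) + count (R′ ∘ (false ∷_))  ≡⟨ count-∷ R′ ⟨
  count R′                                          ∎
  where open ≡-Reasoning

sum-of-halves : ∀ {n a b} → a ≡ 2 ^ n → b ≡ 2 ^ n → a + b ≡ 2 ^ suc n
sum-of-halves {n} refl refl = cong (2 ^ n +_) (sym (+-identityʳ (2 ^ n)))

count-true : ∀ n → count {n} (λ _ → true) ≡ 2 ^ n
count-true zero    = refl
count-true (suc n) =
  trans (count-∷ {n} (λ _ → true)) (sum-of-halves {n} (count-true n) (count-true n))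

count-complement : ∀ {n} (R : Vec Bool n → Bool) → count R + count (not ∘ R) ≡ 2 ^ n
count-complement {zero} R with R []
... | true  = refl
... | false = refl
count-complement {suc n} R = begin
  count R + count (not ∘ R)
    ≡⟨ cong₂ _+_ (count-∷ R) (count-∷ (not ∘ R)) ⟩
  (count R₁ + count R₀) + (count (not ∘ R₁) + count (not ∘ R₀))
    ≡⟨ regroup (count R₁) (count R₀) _ _ ⟩
  (count R₁ + count (not ∘ R₁)) + (count R₀ + count (not ∘ R₀))
    ≡⟨ sum-of-halves {n} (count-complement R₁) (count-complement R₀) ⟩
  2 ^ suc n
    ∎
  where
  open ≡-Reasoning
  R₁ R₀ : Vec Bool n → Bool
  R₁ = R ∘ (true ∷_)
  R₀ = R ∘ (false ∷_)
  regroup : ∀ a b c d → (a + b) + (c + d) ≡ (a + c) + (b + d)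
  regroup = solve-∀

Flips : ∀ {n} → (Vec Bool n → Bool) → Fin n → Set
Flips R k = ∀ w → R (w [ k ]%= not) ≡ not (R w)

count-Flips : ∀ {n} (R : Vec Bool (suc n) → Bool) (k : Fin (suc n)) → Flips R k → count R ≡ 2 ^ n
count-Flips {n} R zero flips = begin
  count R                                              ≡⟨ count-∷ R ⟩
  count (R ∘ (true ∷_)) + count (R ∘ (false ∷_))       ≡⟨ cong (count (R ∘ (true ∷_)) +_)
                                                              (count-cong (flips ∘ (true ∷_))) ⟩
  count (R ∘ (true ∷_)) + count (not ∘ R ∘ (true ∷_))  ≡⟨ count-complement (R ∘ (true ∷_)) ⟩
  2 ^ n                                                ∎
  where open ≡-Reasoning
count-Flips {suc n} R (suc k) flips =
  trans (count-∷ R) (sum-of-halves {n} (count-Flips _ k (flips ∘ (true ∷_)))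
                                       (count-Flips _ k (flips ∘ (false ∷_))))

allPairs-lookup : ∀ {A : Set} {R : A → A → Set} {xs : List A} → AllPairs R xs →
                  ∀ {i j : Fin (length xs)} → toℕ i < toℕ j → R (lookup xs i) (lookup xs j)
allPairs-lookup (Rx ∷ _)   {zero}  {suc j} _         = All.lookup Rx (∈-lookup j)
allPairs-lookup (_ ∷ Rxs) {suc i} {suc j} (s≤s i<j) = allPairs-lookup Rxs i<j

unique⇒length≤ : ∀ {m} {xs : List (Fin m)} → Unique xs → length xs ≤ m
unique⇒length≤ {m} {xs} unique with m <? length xs
... | no  m≮ = ≮⇒≥ m≮
... | yes m< with pigeonhole m< (lookup xs)
...   | i , j , i<j , same = contradiction same (allPairs-lookup unique i<j)

injective⇒2^n≤ : ∀ {n m} {g : Vec Bool n → Fin m} → (∀ {u v} → g u ≡ g v → u ≡ v) → 2 ^ n ≤ m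
injective⇒2^n≤ {n} {m} {g} injective = begin
  2 ^ n                     ≡⟨ count-true n ⟨
  length vectors            ≡⟨ length-map g vectors ⟨
  length (map g vectors)    ≤⟨ unique⇒length≤ (Unique.map⁺ injective (satisfying-unique _)) ⟩
  m                         ∎
  where
  open ≤-Reasoning
  vectors = satisfying {n} (λ _ → true)

-- Lower bound

flip-involutive : ∀ {n} (w : Vec Bool n) (k : Fin n) → w [ k ]%= not [ k ]%= not ≡ w
flip-involutive w k = trans ([]%=-∘ w k) (trans (updateAt-cong k not-involutive w) ([]%=-id w k))

flip-last : ∀ {n} (v : Vec Bool n) (c : Bool) → (v ∷ʳ c) [ fromℕ n ]%= not ≡ v ∷ʳ not c
flip-last []      c = refl
flip-last (x ∷ v) c = cong (x ∷_) (flip-last v c)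

bottom-twins : ∀ {n} (x : Vec Bool (suc n)) {y} →
               BFEdge (suc n) y (x , zero) → BFEdge (suc n) y (x [ zero ]%= not , zero)
bottom-twins x (inj₁ (() , _))
bottom-twins x (inj₂ (lv , inj₁ refl)) =
  inj₂ (lv , inj₂ (zero , sym lv , sym (flip-involutive x zero)))
bottom-twins x (inj₂ (lv , inj₂ (zero , _ , refl))) = inj₂ (lv , inj₁ refl)
bottom-twins x (inj₂ (lv , inj₂ (suc k , k≡ , _))) with trans k≡ lv
... | ()

top-twins : ∀ {n} (x : Vec Bool (suc n)) {y} →
            BFEdge (suc n) y (x , fromℕ (suc n)) →
            BFEdge (suc n) y (x [ fromℕ n ]%= not , fromℕ (suc n))
top-twins {n} x {_ , j} (inj₂ (lv , _)) =
  ⊥-elim (<⇒≢ (toℕ<n j) (trans lv (cong suc (toℕ-fromℕ (suc n)))))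
top-twins {n} x (inj₁ (lv , inj₁ refl)) = inj₁ (lv , inj₂ (fromℕ n , refl , refl))
top-twins {n} _ {y , _} (inj₁ (lv , inj₂ (k , k≡ , refl)))
  with toℕ-injective {i = k} {j = fromℕ n} (suc-injective k≡)
... | refl = inj₁ (lv , inj₁ (sym (flip-involutive y (fromℕ n))))

module LowerBound (n : ℕ) where

  r : ℕ
  r = suc (suc n)

  -- u = 0v stands for the twin pair {[0v;0], [1v;0]}, and u = 1v for {[v0;r], [v1;r]}.
  twin : Bool → Vec Bool r → BFVertex r
  twin c (false ∷ v) = c ∷ v , zero
  twin c (true ∷ v)  = v ∷ʳ c , fromℕ r

  pairOf : BFVertex r → Vec Bool r
  pairOf (w , zero)  = false ∷ tail w
  pairOf (w , suc _) = true ∷ init w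

  pairOf-twin : ∀ c u → pairOf (twin c u) ≡ u
  pairOf-twin c (false ∷ v) = refl
  pairOf-twin c (true ∷ v)  = cong (true ∷_) (init-∷ʳ c v)

  twins-distinct : ∀ u → twin false u ≢ twin true u
  twins-distinct (false ∷ v) ()
  twins-distinct (true ∷ v) same with ∷ʳ-injectiveʳ v v (cong proj₁ same)
  ... | ()

  twin-neighbours : ∀ c u {y} → BFEdge r y (twin c u) → BFEdge r y (twin (not c) u)
  twin-neighbours c (false ∷ v) = bottom-twins (c ∷ v)
  twin-neighbours c (true ∷ v)  =
    subst (λ x → BFEdge r _ (x , fromℕ r)) (flip-last v c) ∘ top-twins (v ∷ʳ c)

  Extreme : BFVertex r → Set
  Extreme (_ , i) = toℕ i ≡ 0 ⊎ toℕ i ≡ r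

  twin-extreme : ∀ c u → Extreme (twin c u)
  twin-extreme c (false ∷ v) = inj₁ refl
  twin-extreme c (true ∷ v)  = inj₂ (toℕ-fromℕ r)

  extreme-levels : ∀ {a b} → a ≡ 0 ⊎ a ≡ r → b ≡ 0 ⊎ b ≡ r → b ≢ suc a
  extreme-levels (inj₁ refl) (inj₁ refl) ()
  extreme-levels (inj₁ refl) (inj₂ refl) ()
  extreme-levels (inj₂ refl) (inj₁ refl) ()
  extreme-levels (inj₂ refl) (inj₂ refl) = <⇒≢ (n<1+n r)

  extremes-nonadjacent : ∀ {x y} → Extreme x → Extreme y → ¬ BFEdge r x y
  extremes-nonadjacent ex ey (inj₁ (lv , _)) = extreme-levels ex ey lv
  extremes-nonadjacent ex ey (inj₂ (lv , _)) = extreme-levels ey ex lv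

  IsEnd : BFVertex r → BFVertex r × BFVertex r → Set
  IsEnd x e = x ≡ proj₁ e ⊎ x ≡ proj₂ e

  extreme-ends-equal : ∀ {x x′} e → BFEdge r (proj₁ e) (proj₂ e) → IsEnd x e → IsEnd x′ e →
                       Extreme x → Extreme x′ → x ≡ x′
  extreme-ends-equal _ _    (inj₁ refl) (inj₁ refl) _  _   = refl
  extreme-ends-equal _ _    (inj₂ refl) (inj₂ refl) _  _   = refl
  extreme-ends-equal _ edge (inj₁ refl) (inj₂ refl) ex ex′ =
    ⊥-elim (extremes-nonadjacent ex ex′ edge)
  extreme-ends-equal _ edge (inj₂ refl) (inj₁ refl) ex ex′ =
    ⊥-elim (extremes-nonadjacent ex′ ex edge)

  module _ (K : List (BFVertex r × BFVertex r)) (forcing : IsEdgeForcingSet (BFEdge r) K) where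

    chosenTwin : ∀ u → Σ Bool λ c → Endpoints K (twin c u)
    chosenTwin u
      with twins-meet (twins-distinct u) (twin-neighbours false u) (twin-neighbours true u)
                      (proj₂ (proj₂ forcing) (twin false u))
    ... | inj₁ t = false , t
    ... | inj₂ t = true , t

    index : Vec Bool r → Fin (length K)
    index u = Any.index (proj₂ (chosenTwin u))

    index-injective : ∀ {u u′} → index u ≡ index u′ → u ≡ u′
    index-injective {u} {u′} same-index with chosenTwin u | chosenTwin u′
    ... | c , p | c′ , p′ = begin
      u                    ≡⟨ pairOf-twin c u ⟨
      pairOf (twin c u)    ≡⟨ cong pairOf same-twin ⟩
      pairOf (twin c′ u′)  ≡⟨ pairOf-twin c′ u′ ⟩
      u′                   ∎
      where
      open ≡-Reasoning
      same-twin : twin c u ≡ twin c′ u′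
      same-twin with All.lookupAny (proj₁ forcing) p | All.lookupAny (proj₁ forcing) p′
      ... | edge , end | _ , end′ =
        extreme-ends-equal _ edge end (subst (IsEnd _) (cong (lookup K) (sym same-index)) end′)
                           (twin-extreme c u) (twin-extreme c′ u′)

lowerBound : ∀ n (K : List (BFVertex (suc (suc n)) × BFVertex (suc (suc n)))) →
             IsEdgeForcingSet (BFEdge (suc (suc n))) K → 2 ^ suc (suc n) ≤ length K
lowerBound n K forcing = injective⇒2^n≤ (LowerBound.index-injective n K forcing)

-- Closing the butterfly level by level

-- Position k : Fin r is the paper's bit k+1, the bit switched by edges into level k+1.
MeetsFlipPairs : ∀ {r} → (BFVertex r → Set) → Fin r → Set
MeetsFlipPairs T k = ∀ w → T (w , suc k) ⊎ T (w [ k ]%= not , suc k)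

meets-by-Flips : ∀ {r} {T : BFVertex r → Set} {k : Fin r} (R : Vec Bool r → Bool) → Flips R k →
                 (∀ w → R w ≡ true → T (w , suc k)) → MeetsFlipPairs T k
meets-by-Flips R flips covered w with R w in Rw
... | true  = inj₁ (covered w Rw)
... | false = inj₂ (covered _ (trans (flips w) (cong not Rw)))

LevelClosed : ∀ {r} → (BFVertex r → Set) → ℕ → Set
LevelClosed {r} T L = ∀ w (i : Fin (suc r)) → toℕ i ≡ L → Closure (BFEdge r) T (w , i)

-- [w;k+1] forces [w;k+2]: its neighbours below are closed and its other neighbour above is the
-- flip partner of [w;k+2].
closed-next-level : ∀ {n} {T : BFVertex (suc n) → Set} (k : Fin n) →
                    LevelClosed T (toℕ k) → LevelClosed T (suc (toℕ k)) → MeetsFlipPairs T (suc k) →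
                    ∀ w → Closure (BFEdge (suc n)) T (w , suc (suc k))
closed-next-level {n} {T} k below closed meets w with meets w
... | inj₁ t = base t
... | inj₂ t = force (closed w (suc (inject₁ k)) (cong suc (toℕ-inject₁ k)))
                     (inj₁ (cong (2 +_) (sym (toℕ-inject₁ k)) , inj₁ refl)) others
  where
  above : ∀ {j} → toℕ j ≡ suc (toℕ (suc (inject₁ k))) → j ≡ suc (suc k)
  above lv = toℕ-injective (trans lv (cong (2 +_) (toℕ-inject₁ k)))

  others : ∀ x → BFEdge (suc n) (w , suc (inject₁ k)) x → x ≢ (w , suc (suc k)) →
           Closure (BFEdge (suc n)) T x
  others (_ , j) (inj₁ (lv , inj₁ refl)) x≢ = ⊥-elim (x≢ (cong (w ,_) (above lv)))
  others (_ , j) (inj₁ (lv , inj₂ (k′ , k′≡ , refl))) _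
    with above lv | toℕ-injective {i = k′} {j = suc k}
                                  (suc-injective (trans k′≡ (cong toℕ (above lv))))
  ... | refl | refl = base t
  others (w′ , j) (inj₂ (lv , _)) _ = below w′ j (trans (suc-injective (sym lv)) (toℕ-inject₁ k))

closure-by-levels : ∀ {n} {T : BFVertex (suc n) → Set} →
                    (∀ w → T (w , zero)) → (∀ w → T (w , suc zero)) →
                    (∀ k → MeetsFlipPairs T (suc k)) → ∀ v → Closure (BFEdge (suc n)) T v
closure-by-levels {n} {T} T₀ T₁ meets (w , i) = proj₁ (levels (toℕ i)) w i refl
  where
  next : ∀ {L} → LevelClosed T L → LevelClosed T (suc L) → LevelClosed T (suc (suc L))
  next c c′ w (suc (suc k)) refl = closed-next-level k c c′ (meets k) w

  levels : ∀ L → LevelClosed T L × LevelClosed T (suc L)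
  levels zero = (λ { w zero _ → base (T₀ w) })
              , (λ { w (suc zero) _ → base (T₁ w) })
  levels (suc L) with levels L
  ... | c , c′ = c′ , next c c′

-- Layers of straight edges

straight : ∀ {r} → Fin r → Vec Bool r → BFVertex r × BFVertex r
straight j w = (w , inject₁ j) , (w , suc j)

straight-edge : ∀ {r} (j : Fin r) w → BFEdge r (proj₁ (straight j w)) (proj₂ (straight j w))
straight-edge j w = inj₁ (cong suc (sym (toℕ-inject₁ j)) , inj₁ refl)

Far : ∀ {r} → Fin r → Fin r → Set
Far j j′ = suc (toℕ j) < toℕ j′ ⊎ suc (toℕ j′) < toℕ j

independent-sym : ∀ {V : Set} {e e′ : V × V} → Independent e e′ → Independent e′ e
independent-sym (ac , ad , bc , bd) = ≢-sym ac , ≢-sym bc , ≢-sym ad , ≢-sym bd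

below-independent : ∀ {r} {j j′ : Fin r} {w w′} → suc (toℕ j) < toℕ j′ →
                    Independent (straight j w) (straight j′ w′)
below-independent {r} {j} {j′} j≪j′ = apart lo₁ hi₁ , apart lo₁ hi₂ , apart lo₂ hi₁ , apart lo₂ hi₂
  where
  apart : ∀ {i i′ : Fin (suc r)} {v v′ : Vec Bool r} → toℕ i ≤ suc (toℕ j) → toℕ j′ ≤ toℕ i′ →
          (v , i) ≢ (v′ , i′)
  apart i≤ ≤i′ same = <⇒≢ (≤-<-trans i≤ (<-≤-trans j≪j′ ≤i′)) (cong (toℕ ∘ proj₂) same)
  lo₁ = ≤-trans (≤-reflexive (toℕ-inject₁ j)) (n≤1+n _)
  lo₂ = ≤-refl
  hi₁ = ≤-reflexive (sym (toℕ-inject₁ j′))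
  hi₂ = n≤1+n (toℕ j′)

straight-independent : ∀ {r} {j j′ : Fin r} {w w′} → w ≢ w′ ⊎ Far j j′ →
                       Independent (straight j w) (straight j′ w′)
straight-independent {r} {w = w} {w′} (inj₁ w≢w′) = apart , apart , apart , apart
  where
  apart : ∀ {i i′ : Fin (suc r)} → (w , i) ≢ (w′ , i′)
  apart = w≢w′ ∘ cong proj₁
straight-independent (inj₂ (inj₁ j≪j′)) = below-independent j≪j′
straight-independent (inj₂ (inj₂ j′≪j)) = independent-sym (below-independent j′≪j)

record Layer (r : ℕ) : Set where
  constructor layer
  field
    position : Fin r
    selected : Vec Bool r → Bool
open Layer

edges : ∀ {r} → Layer r → List (BFVertex r × BFVertex r)
edges L = map (straight (position L)) (satisfying (selected L))

Compatible : ∀ {r} → Layer r → Layer r → Set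
Compatible L L′ =
  Far (position L) (position L′) ⊎ (∀ w → selected L w ≡ true → selected L′ w ≡ false)

edges-independent : ∀ {r} (L : Layer r) → AllPairs Independent (edges L)
edges-independent L =
  AllPairs.map⁺ (AllPairs.map (straight-independent ∘ inj₁) (satisfying-unique (selected L)))

compatible-independent : ∀ {r} {L L′ : Layer r} → Compatible L L′ →
                         All (λ e → All (Independent e) (edges L′)) (edges L)
compatible-independent (inj₁ far) =
  All.map⁺ (All.universal (λ _ → All.map⁺ (All.universal (λ _ → straight-independent (inj₂ far)) _))
                          _)
compatible-independent {L = L} {L′} (inj₂ disjoint) =
  All.map⁺ (All.map (λ Lw → All.map⁺ (All.map (λ L′w′ → straight-independent (inj₁ (apart Lw L′w′)))
                                              (satisfying-sound (selected L′))))
                    (satisfying-sound (selected L)))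
  where
  apart : ∀ {w w′} → selected L w ≡ true → selected L′ w′ ≡ true → w ≢ w′
  apart {w} Lw L′w′ refl with trans (sym L′w′) (disjoint w Lw)
  ... | ()

layerEdges : ∀ {r} → List (Layer r) → List (BFVertex r × BFVertex r)
layerEdges = concatMap edges

layerEdges-valid : ∀ {r} (Ls : List (Layer r)) →
                   All (λ e → BFEdge r (proj₁ e) (proj₂ e)) (layerEdges Ls)
layerEdges-valid Ls = All.concat⁺ (All.map⁺ (All.universal valid Ls))
  where valid = λ L → All.map⁺ (All.universal (straight-edge (position L)) _)

layerEdges-independent : ∀ {r} {Ls : List (Layer r)} → AllPairs Compatible Ls →
                         AllPairs Independent (layerEdges Ls)
layerEdges-independent compatible =
  AllPairs.concat⁺ (All.map⁺ (All.universal edges-independent _))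
                   (AllPairs.map⁺ (AllPairs.map compatible-independent compatible))

layerEdges-endpoint : ∀ {r} (Ls : List (Layer r)) {L w x} → L ∈ Ls → selected L w ≡ true →
                      x ≡ proj₁ (straight (position L) w) ⊎ x ≡ proj₂ (straight (position L) w) →
                      Endpoints (layerEdges Ls) x
layerEdges-endpoint _ {L} L∈Ls Lw end =
  Any.concat⁺ (Any.map⁺ (Any.map (λ { refl → Any.map⁺ (Any.map (λ { refl → end })
                                                               (∈-satisfying (selected L) Lw)) })
                                 L∈Ls))

length-layerEdges-∷ : ∀ {r} (L : Layer r) Ls →
                      length (layerEdges (L ∷ Ls)) ≡ count (selected L) + length (layerEdges Ls)
length-layerEdges-∷ L Ls =
  trans (length-++ (edges L))
        (cong (_+ length (layerEdges Ls)) (length-map _ (satisfying (selected L))))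

length-layerEdges-uniform : ∀ {r} {A : Set} (f : A → Layer r) {c} →
                            (∀ x → count (selected (f x)) ≡ c) →
                            ∀ xs → length (layerEdges (map f xs)) ≡ length xs * c
length-layerEdges-uniform f counts []       = refl
length-layerEdges-uniform f counts (x ∷ xs) =
  trans (length-layerEdges-∷ (f x) (map f xs))
        (cong₂ _+_ (counts x) (length-layerEdges-uniform f counts xs))

-- Upper bound

parityFrom : ∀ {n} → ℕ → Vec Bool n → Bool
parityFrom _       []      = false
parityFrom zero    (x ∷ w) = x xor parityFrom zero w
parityFrom (suc p) (_ ∷ w) = parityFrom p w

parityFrom-Flips : ∀ {n} p (k : Fin n) → p ≤ toℕ k → Flips (parityFrom p) k
parityFrom-Flips zero    zero    _         (x ∷ w) = sym (not-distribˡ-xor x _)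
parityFrom-Flips zero    (suc k) _         (x ∷ w) =
  trans (cong (x xor_) (parityFrom-Flips zero k z≤n w)) (sym (not-distribʳ-xor x _))
parityFrom-Flips (suc p) (suc k) (s≤s p≤k) (_ ∷ w) = parityFrom-Flips p k p≤k w

suc-double-< : ∀ {a b} → a < b → suc (2 * a) < 2 * b
suc-double-< {a} {b} a<b = subst (_≤ 2 * b) (*-suc 2 a) (*-monoʳ-≤ 2 a<b)

toℕ-double : ∀ {n} (t : Fin n) → toℕ (combine t (zero {1})) ≡ 2 * toℕ t
toℕ-double t = trans (toℕ-combine t zero) (+-identityʳ _)

double-far : ∀ {n} {a b : Fin n} → toℕ a < toℕ b →
             suc (toℕ (combine a (zero {1}))) < toℕ (combine b (zero {1}))
double-far {a = a} {b} a<b =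
  subst₂ (λ x y → suc x < y) (sym (toℕ-double a)) (sym (toℕ-double b)) (suc-double-< a<b)

inject₁-double+1 : ∀ {n} (t : Fin n) → inject₁ (combine t (suc (zero {0}))) ≡ suc (combine t zero)
inject₁-double+1 t = toℕ-injective (begin
  toℕ (inject₁ (combine t (suc zero)))  ≡⟨ toℕ-inject₁ _ ⟩
  toℕ (combine t (suc zero))            ≡⟨ toℕ-combine t (suc zero) ⟩
  2 * toℕ t + 1                         ≡⟨ +-suc _ 0 ⟩
  suc (2 * toℕ t + 0)                   ≡⟨ cong suc (toℕ-combine t zero) ⟨
  toℕ (suc (combine t zero))            ∎)
  where open ≡-Reasoning

module Construction (m : ℕ) where

  r : ℕ
  r = suc (suc m) * 2

  bottom top : Layer r
  bottom = layer zero (λ _ → true)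
  top    = layer (fromℕ _) (parityFrom (suc (2 * m)))

  -- middle t is the layer at level 2t+2; parityFrom p is the parity of the paper's bits p+1, …, r.
  middle : Fin (suc m) → Layer r
  middle t = layer (suc (suc (combine t zero))) (not ∘ parityFrom (suc (2 * toℕ t)))

  middles layers : List (Layer r)
  middles = map middle (allFin (suc m))
  layers  = bottom ∷ top ∷ middles

  K : List (BFVertex r × BFVertex r)
  K = layerEdges layers

  middle∈layers : ∀ t → middle t ∈ layers
  middle∈layers t = there (there (∈-map⁺ middle (∈-allFin t)))

  top-Flips : Flips (selected top) (position top)
  top-Flips = parityFrom-Flips _ _ (begin
    suc (2 * m)         ≡⟨ cong suc (*-comm 2 m) ⟩
    suc (m * 2)         ≤⟨ m≤n+m _ 2 ⟩
    3 + m * 2           ≡⟨ toℕ-fromℕ _ ⟨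
    toℕ (position top)  ∎)
    where open ≤-Reasoning

  middle-Flips : ∀ t (b : Fin 2) → Flips (selected (middle t)) (suc (inject₁ (combine t b)))
  middle-Flips t b w = cong not (parityFrom-Flips _ _ (s≤s (begin
    2 * toℕ t                    ≤⟨ m≤m+n _ (toℕ b) ⟩
    2 * toℕ t + toℕ b            ≡⟨ toℕ-combine t b ⟨
    toℕ (combine t b)            ≡⟨ toℕ-inject₁ _ ⟨
    toℕ (inject₁ (combine t b))  ∎)) w)
    where open ≤-Reasoning

  top-compatible-middle : ∀ t → Compatible top (middle t)
  top-compatible-middle t with toℕ t <? m
  ... | yes t<m = inj₁ (inj₂ (begin-strict
    3 + toℕ (combine t zero)  ≡⟨ cong (3 +_) (toℕ-double t) ⟩
    3 + 2 * toℕ t             <⟨ s≤s (s≤s (s≤s (≤-trans (n≤1+n _) (suc-double-< t<m)))) ⟩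
    3 + 2 * m                 ≡⟨ cong (3 +_) (*-comm 2 m) ⟩
    3 + m * 2                 ≡⟨ toℕ-fromℕ _ ⟨
    toℕ (position top)        ∎))
    where open ≤-Reasoning
  ... | no  t≮m = inj₂ λ w top-w →
    cong not (trans (cong (λ p → parityFrom (suc (2 * p)) w) t≡m) top-w)
    where
    t≡m : toℕ t ≡ m
    t≡m = ≤-antisym (≤-pred (toℕ<n t)) (≮⇒≥ t≮m)

  middles-far : ∀ {t t′} → t ≢ t′ → Compatible (middle t) (middle t′)
  middles-far {t} {t′} t≢t′ with <-cmp (toℕ t) (toℕ t′)
  ... | tri< t<t′ _ _ = inj₁ (inj₁ (s≤s (s≤s (double-far t<t′))))
  ... | tri≈ _ t≡t′ _ = contradiction (toℕ-injective t≡t′) t≢t′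
  ... | tri> _ _ t′<t = inj₁ (inj₂ (s≤s (s≤s (double-far t′<t))))

  layers-compatible : AllPairs Compatible layers
  layers-compatible =
      (inj₁ (inj₁ (subst (1 <_) (sym (toℕ-fromℕ _)) (s≤s (s≤s z≤n))))
        ∷ All.map⁺ (All.universal (λ _ → inj₁ (inj₁ (s≤s (s≤s z≤n)))) (allFin (suc m))))
    ∷ All.map⁺ (All.universal top-compatible-middle (allFin (suc m)))
    ∷ AllPairs.map⁺ (AllPairs.map middles-far (Unique.allFin⁺ (suc m)))

  endpoint : ∀ {L w x} → L ∈ layers → selected L w ≡ true →
             x ≡ proj₁ (straight (position L) w) ⊎ x ≡ proj₂ (straight (position L) w) →
             Endpoints K x
  endpoint = layerEdges-endpoint layers

  meets-middle : ∀ t (b : Fin 2) → MeetsFlipPairs (Endpoints K) (suc (inject₁ (combine t b)))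
  meets-middle t zero =
    meets-by-Flips {T = Endpoints K} _ (middle-Flips t zero)
      (λ w selected → endpoint (middle∈layers t) selected (inj₁ refl))
  meets-middle t (suc zero) =
    meets-by-Flips {T = Endpoints K} _ (middle-Flips t (suc zero))
      (λ w selected → subst (λ j → Endpoints K (w , suc (suc j))) (sym (inject₁-double+1 t))
                            (endpoint (middle∈layers t) selected (inj₂ refl)))

  meets : ∀ k → MeetsFlipPairs (Endpoints K) (suc k)
  meets k with view k
  ... | ‵fromℕ =
    meets-by-Flips {T = Endpoints K} _ top-Flips
      (λ w selected → endpoint (there (here refl)) selected (inj₂ refl))
  ... | ‵inject₁ i =
    subst (λ i → MeetsFlipPairs (Endpoints K) (suc (inject₁ i))) (combine-remQuot {suc m} 2 i)
          (meets-middle (proj₁ (remQuot {suc m} 2 i)) (proj₂ (remQuot {suc m} 2 i)))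

  K-forcing : IsEdgeForcingSet (BFEdge r) K
  K-forcing = layerEdges-valid layers
            , layerEdges-independent layers-compatible
            , closure-by-levels (λ w → endpoint (here refl) refl (inj₁ refl))
                                (λ w → endpoint (here refl) refl (inj₂ refl))
                                meets

  length-K : length K ≡ (r / 2 + 2) * 2 ^ (r ∸ 1)
  length-K = begin
    length K
      ≡⟨ length-layerEdges-∷ bottom (top ∷ middles) ⟩
    count (selected bottom) + length (layerEdges (top ∷ middles))
      ≡⟨ cong (count (selected bottom) +_) (length-layerEdges-∷ top middles) ⟩
    count (selected bottom) + (count (selected top) + length (layerEdges middles))
      ≡⟨ cong₂ _+_ (count-true r)
                   (cong₂ _+_ (count-Flips _ (position top) top-Flips)
                              (length-layerEdges-uniform middle count-middle (allFin (suc m)))) ⟩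
    2 * X + (X + length (allFin (suc m)) * X)
      ≡⟨ cong (λ l → 2 * X + (X + l * X)) (length-tabulate {n = suc m} (λ i → i)) ⟩
    2 * X + (X + suc m * X)
      ≡⟨ regroup m X ⟩
    (suc (suc m) + 2) * X
      ≡⟨ cong (λ q → (q + 2) * X) (m*n/n≡m (suc (suc m)) 2) ⟨
    (r / 2 + 2) * X
      ∎
    where
    open ≡-Reasoning
    X = 2 ^ (r ∸ 1)
    count-middle : ∀ t → count (selected (middle t)) ≡ X
    count-middle t = count-Flips _ _ (middle-Flips t zero)
    regroup : ∀ m X → 2 * X + (X + suc m * X) ≡ (suc (suc m) + 2) * X
    regroup = solve-∀

upperBound : ∀ m → let r = suc (suc m) * 2 in
             Σ (List (BFVertex r × BFVertex r))
               (λ K → IsEdgeForcingSet (BFEdge r) K × length K ≤ (r / 2 + 2) * 2 ^ (r ∸ 1))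
upperBound m = K , K-forcing , ≤-reflexive length-K
  where open Construction m

theorem4p11 : (r : ℕ) → 4 ≤ r → 2 ∣ r →
    ((K : List (BFVertex r × BFVertex r)) → IsEdgeForcingSet (BFEdge r) K → 2 ^ r ≤ length K)
    × Σ (List (BFVertex r × BFVertex r))
        (λ K → IsEdgeForcingSet (BFEdge r) K × length K ≤ (r / 2 + 2) * 2 ^ (r ∸ 1))
theorem4p11 _ () (divides zero refl)
theorem4p11 _ (s≤s (s≤s ())) (divides (suc zero) refl)
theorem4p11 _ _ (divides (suc (suc m)) refl) = lowerBound _ , upperBound m
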